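{- Let $l$ be a positive integer. Every $l$-EPS-graph is $1$-critical, but not $0$-critical.
   Context: All graphs are finite and simple. $\operatorname{Forb}(H)$ is the family of graphs with no induced subgraph isomorphic to $H$. $\mathcal{H}(s,t)$ is the family of graphs whose vertex set can be partitioned into $s$ stable sets and $t$ cliques. For a hereditary family $\mathcal{F}$, $\chi_c(\mathcal{F})$ is the maximum $l$ with $\mathcal{H}(s,l-s)\subseteq\mathcal{F}$ for some $0\le s\le l$. For $l=\chi_c(\mathcal{F})$, a graph $J$ is $\mathcal{F}$-reduced if for some $0\le s\le l-1$, $\mathcal{F}$ contains every graph whose vertex set can be partitioned into $l$ parts where the first part induces a graph isomorphic to an induced subgraph of $J$, $s$ other parts are stable sets and the remaining $l-1-s$ are cliques; $\operatorname{red}(\mathcal{F})$ is the family of $\mathcal{F}$-reduced graphs. A graph $G$ is an $s$-star if there is $S\subseteq V(G)$, $|S|\le s$, such that $V(G)\setminus S$ is a clique or stable set and each vertex of $S$ is adjacent to all or to none of $V(G)\setminus S$. A graph $H$ is $s$-critical if there is $n_0$ such that every $K\in\operatorname{red}(\operatorname{Forb}(H))$ with $|V(K)|\ge n_0$ is an $s$-star. Notation: $\mathcal{C}$ is the family of complete graphs; $S_2$ the edgeless graph on two vertices; $K_2$ the single edge; $\iota(J)$ the family of graphs isomorphic to induced subgraphs of $J$; $\mathcal{F}_1\vee\mathcal{F}_2$ (resp. $\mathcal{F}_1\wedge\mathcal{F}_2$) the family of disjoint unions (resp. joins) of a graph in $\mathcal{F}_1$ and a graph in $\mathcal{F}_2$;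 $\mathcal{C}^+$ is the family of graphs $G$ that are complete or such that $G\setminus v$ is complete for some vertex $v$ of degree at most $1$. A star is $K_{1,m}$. A graph $H$ is an $l$-EPS-graph if: (EPS1) for every $1\le s\le l$, $V(H)$ can be partitioned into $s$ stable sets and $l-s$ cliques; (EPS2) for each $\mathcal{G}\in\{\iota(S_2)\vee\mathcal{C},\ \iota(K_2)\vee\mathcal{C},\ \iota(S_2)\wedge\mathcal{C},\ \mathcal{C}^+\}$, $V(H)$ can be partitioned into $l-1$ cliques and a set inducing a graph in $\mathcal{G}$; (EPS3) there is no partition $(X_1,\dots,X_l)$ of $V(H)$ such that $H[X_1]$ is a clique or the complement of a star and $X_i$ is a clique of $H$ for $2\le i\le l$. -}

module Defs where

open import Data.Nat using (ℕ; zero; suc; _+_; _∸_; _≤_; _<_)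
open import Data.Fin using (Fin; zero; suc; _↑ˡ_; _↑ʳ_)
open import Data.Fin.Subset using (Subset; _∈_; _∉_; ∣_∣)
open import Data.Bool using (Bool; true; false)
open import Data.Product using (Σ; _×_; _,_)
open import Data.Sum using (_⊎_)
open import Relation.Nullary using (¬_)
open import Relation.Binary.PropositionalEquality using (_≡_; _≢_; refl)
open import Function.Definitions using (Injective)

record Graph : Set where
  constructor mkGraph
  field
    n     : ℕ
    adj   : Fin n → Fin n → Bool
    sym   : ∀ u v → adj u v ≡ adj v u
    irrfl : ∀ v → adj v v ≡ false
open Graph public

-- A family of graphs (intended to be closed under isomorphism).
Family : Set₁
Family = Graph → Set

VSet : Graph → Set₁
VSet G = Fin (n G) → Set

Contains : Graph → Graph → Set
Contains G H =
  Σ (Fin (n H) → Fin (n G)) λ f →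
    Injective _≡_ _≡_ f × (∀ a b → adj H a b ≡ adj G (f a) (f b))

ι : Graph → Family
ι J K = Contains J K

Forb : Graph → Family
Forb H G = ¬ Contains G H

InducedIn : (G : Graph) → VSet G → Family → Set
InducedIn G X 𝒢 =
  Σ Graph λ K → 𝒢 K ×
    Σ (Fin (n K) → Fin (n G)) λ f →
      Injective _≡_ _≡_ f
      × (∀ a → X (f a))
      × (∀ v → X v → Σ (Fin (n K)) λ a → f a ≡ v)
      × (∀ a b → adj K a b ≡ adj G (f a) (f b))

StablePart : (G : Graph) → VSet G → Set
StablePart G X = ∀ u v → X u → X v → adj G u v ≡ false

CliquePart : (G : Graph) → VSet G → Set
CliquePart G X = ∀ u v → X u → X v → u ≢ v → adj G u v ≡ true

Part : (G : Graph) {k : ℕ} → (Fin (n G) → Fin k) → Fin k → VSet G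
Part G c i v = c v ≡ i

-- 𝓗(s,t): V(G) partitioned into s stable sets and t cliques
-- (parts may be empty). Parts  i ↑ˡ t  (i < s) are stable,
-- parts  s ↑ʳ j  (j < t) are cliques.

InH : ℕ → ℕ → Family
InH s t G =
  Σ (Fin (n G) → Fin (s + t)) λ c →
    (∀ (i : Fin s) → StablePart G (Part G c (i ↑ˡ t)))
    × (∀ (j : Fin t) → CliquePart G (Part G c (s ↑ʳ j)))

_⊆F_ : Family → Family → Set
𝓐 ⊆F 𝓑 = ∀ G → 𝓐 G → 𝓑 G

ChiC : Family → ℕ → Set
ChiC 𝓕 l =
  (Σ ℕ λ s → s ≤ l × (InH s (l ∸ s) ⊆F 𝓕))
  × (∀ l′ s → s ≤ l′ → InH s (l′ ∸ s) ⊆F 𝓕 → l′ ≤ l)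

-- J is 𝓕-reduced: with l = χ_c(𝓕) and some 0 ≤ s ≤ l-1, 𝓕 contains every
-- graph partitioned into l parts: part 0 inducing a graph in ι(J),
-- parts  suc (i ↑ˡ t)  (i < s) stable, parts  suc (s ↑ʳ j)  (j < t) cliques,
-- where t = l - 1 - s.
Reduced : Family → Graph → Set
Reduced 𝓕 J =
  Σ ℕ λ l → ChiC 𝓕 l ×
    Σ ℕ λ s → s < l ×
      (∀ (G : Graph) (c : Fin (n G) → Fin (suc (s + (l ∸ 1 ∸ s)))) →
         InducedIn G (Part G c zero) (ι J) →
         (∀ (i : Fin s) → StablePart G (Part G c (suc (i ↑ˡ (l ∸ 1 ∸ s))))) →
         (∀ (j : Fin (l ∸ 1 ∸ s)) → CliquePart G (Part G c (suc (s ↑ʳ j)))) →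
         𝓕 G)

IsSStar : ℕ → Graph → Set
IsSStar s G =
  Σ (Subset (n G)) λ S →
    ∣ S ∣ ≤ s
    × (CliquePart G (λ v → v ∉ S) ⊎ StablePart G (λ v → v ∉ S))
    × (∀ v → v ∈ S →
         (∀ u → u ∉ S → adj G v u ≡ true) ⊎ (∀ u → u ∉ S → adj G v u ≡ false))

Critical : ℕ → Graph → Set
Critical s H =
  Σ ℕ λ n₀ → ∀ (K : Graph) → Reduced (Forb H) K → n₀ ≤ n K → IsSStar s K

S₂ : Graph
S₂ = mkGraph 2 (λ _ _ → false) (λ _ _ → refl) (λ _ → refl)

K₂adj : Fin 2 → Fin 2 → Bool
K₂adj zero zero = false
K₂adj zero (suc zero) = true
K₂adj (suc zero) zero = true
K₂adj (suc zero) (suc zero) = false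

K₂sym : ∀ u v → K₂adj u v ≡ K₂adj v u
K₂sym zero zero = refl
K₂sym zero (suc zero) = refl
K₂sym (suc zero) zero = refl
K₂sym (suc zero) (suc zero) = refl

K₂irr : ∀ v → K₂adj v v ≡ false
K₂irr zero = refl
K₂irr (suc zero) = refl

K₂ : Graph
K₂ = mkGraph 2 K₂adj K₂sym K₂irr

Complete : Family
Complete G = ∀ u v → u ≢ v → adj G u v ≡ true

_∨F_ : Family → Family → Family
(𝓕₁ ∨F 𝓕₂) G =
  Σ (Fin (n G) → Bool) λ A →
    InducedIn G (λ v → A v ≡ true) 𝓕₁
    × InducedIn G (λ v → A v ≡ false) 𝓕₂
    × (∀ u v → A u ≡ true → A v ≡ false → adj G u v ≡ false)

_∧F_ : Family → Family → Family
(𝓕₁ ∧F 𝓕₂) G =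
  Σ (Fin (n G) → Bool) λ A →
    InducedIn G (λ v → A v ≡ true) 𝓕₁
    × InducedIn G (λ v → A v ≡ false) 𝓕₂
    × (∀ u v → A u ≡ true → A v ≡ false → adj G u v ≡ true)

-- 𝓒⁺ : G complete, or G \ v complete for some v of degree ≤ 1
-- (degree ≤ 1 written as: v has at most one neighbour).
Cplus : Family
Cplus G =
  Complete G
  ⊎ Σ (Fin (n G)) λ v →
      (∀ u w → adj G v u ≡ true → adj G v w ≡ true → u ≡ w)
      × (∀ u w → u ≢ v → w ≢ v → u ≢ w → adj G u w ≡ true)

-- Complement of a star K_{1,m}: a vertex v nonadjacent to all others,
-- the others pairwise adjacent (and at least one vertex, namely v).
CoStar : Family
CoStar G =
  Σ (Fin (n G)) λ v →
    (∀ u → adj G v u ≡ false)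
    × (∀ u w → u ≢ v → w ≢ v → u ≢ w → adj G u w ≡ true)

CliquesPlus : ℕ → Family → Graph → Set
CliquesPlus l 𝒢 H =
  Σ (Fin (n H) → Fin l) λ c → Σ (Fin l) λ i →
    InducedIn H (Part H c i) 𝒢
    × (∀ j → j ≢ i → CliquePart H (Part H c j))

EPS : ℕ → Graph → Set
EPS l H =
  -- (EPS1)
  (∀ s → 1 ≤ s → s ≤ l → InH s (l ∸ s) H)
  -- (EPS2)
  × CliquesPlus l (ι S₂ ∨F Complete) H
  × CliquesPlus l (ι K₂ ∨F Complete) H
  × CliquesPlus l (ι S₂ ∧F Complete) H
  × CliquesPlus l Cplus H
  -- (EPS3)
  × ¬ CliquesPlus l (λ K → Complete K ⊎ CoStar K) H

module Submission where

-- Let N = |V(H)|.  (EPS3) says that H is not a union of l cliques, while (EPS1) and a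
-- splitting of the (ι K₂ ∨ 𝒞)-part of (EPS2) into two cliques put H into every 𝓗(s, l′ - s)
-- with l′ > l; hence χ_c(Forb H) = l.  If K is Forb(H)-reduced with s stable parts, then
-- K contains no stable set of size N (else an (EPS1)-partition of H with s + 1 stable sets
-- is of the reducing shape) and, for s ≥ 1, no clique of size N either.  By Ramsey's
-- theorem a large reduced K thus has s = 0 and a clique Q of size 2N, and the four
-- families of (EPS2) forbid in K four configurations: two vertices with prescribed
-- adjacencies to each other and to a clique of size N.  These force all but at most one
-- vertex of K to be adjacent to all of Q; those vertices form a clique, and the exception
-- sees none of them, so K is a 1-star.  Conversely, (EPS3) makes every co-star K₁ + K_m
-- Forb(H)-reduced, and these are not 0-stars.

open import Defs hiding (sym)
open import Data.Bool using (Bool; true; false; if_then_else_)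
open import Data.Bool.Properties using () renaming (_≟_ to _≟ᵇ_)
open import Data.Empty using (⊥-elim)
open import Data.Fin using (Fin; zero; suc; inject≤; _≟_; _↑ˡ_; _↑ʳ_; splitAt; join; lift)
open import Data.Fin.Properties using (inject≤-injective; suc-injective; ↑ˡ-injective; ↑ʳ-injective;
  splitAt-↑ˡ; splitAt-↑ʳ; splitAt⁻¹-↑ˡ; splitAt⁻¹-↑ʳ; 0≢1+n; injective⇒≤; ¬∀⟶∃¬; any?; all?)
import Data.Fin.Permutation.Components as Perm
open import Data.Fin.Subset using (Subset; ⊥; ⁅_⁆; _∉_; _∈_; ∣_∣)
open import Data.Fin.Subset.Properties using (∣⊥∣≡0; ∉⊥; ∣⁅x⁆∣≡1; x∈⁅x⁆; x∈⁅y⁆⇒x≡y; p⊆q⇒∣p∣≤∣q∣)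
open import Data.List using (List; []; _∷_; length; lookup; filter; allFin)
open import Data.List.Properties using (length-tabulate)
open import Data.List.Relation.Unary.All as All using (All; []; _∷_)
open import Data.List.Relation.Unary.All.Properties using (all-filter)
open import Data.List.Relation.Unary.AllPairs as AllPairs using (AllPairs; []; _∷_)
import Data.List.Relation.Unary.AllPairs.Properties as AllPairs
open import Data.List.Relation.Unary.Any using (here; there; index)
open import Data.List.Relation.Unary.Any.Properties using (lookup-index)
open import Data.List.Relation.Unary.Unique.Propositional using (Unique)
open import Data.List.Relation.Unary.Unique.Propositional.Properties using (allFin⁺)
import Data.List.Relation.Unary.Unique.Propositional.Properties as Unique
open import Data.List.Relation.Binary.Subset.Propositional using (_⊆_)
open import Data.List.Relation.Binary.Subset.Propositional.Properties using (All-resp-⊇; filter-⊆)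
import Data.List.Membership.Propositional as List
open import Data.List.Membership.Propositional.Properties
  using (∈-lookup; ∈-filter⁺; ∈-filter⁻; ∈-allFin)
open import Data.Nat using (ℕ; zero; suc; _+_; _∸_; _≤_; _<_; _≤?_; z≤n; s≤s)
open import Data.Nat.Properties using (≤-trans; ≤-refl; ≤-reflexive; ≤-antisym; ≰⇒>; <⇒≤; <-irrefl;
  +-cancelˡ-≤; +-monoˡ-≤; n≤1+n; +-suc; ∸-monoˡ-≤; n∸n≡0; m≤m+n; m≤n+m; +-∸-assoc)
open import Data.Product using (Σ; _×_; _,_; proj₁; proj₂)
open import Data.Sum using (_⊎_; inj₁; inj₂)
import Data.Sum as Sum
import Data.Vec.Functional as Vector
open import Function using (_∘_; id; const)
open import Function.Definitions using (Injective)
open import Relation.Nullary using (¬_; Dec; yes; no; does; ¬?; _→-dec_)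
open import Relation.Nullary.Decidable using (decidable-stable)
open import Relation.Unary using (Decidable)
open import Relation.Binary.PropositionalEquality using (_≡_; _≢_; refl; sym; trans; cong; cong₂; subst)

private
  variable
    A : Set
    G H J K L : Graph
    𝒢 𝒢′ 𝓕 : Family
    α β β′ γ δ : Bool
    l m s t s′ t′ : ℕ

-- Embeddings and uniform graphs

true≢false : true ≢ false
true≢false ()

contains-refl : Contains G G
contains-refl = (λ v → v) , (λ e → e) , (λ _ _ → refl)

contains-trans : Contains G K → Contains K L → Contains G L
contains-trans (f , f-inj , f-adj) (g , g-inj , g-adj) =
  f ∘ g , g-inj ∘ f-inj , λ a b → trans (g-adj a b) (f-adj (g a) (g b))

adj-sym : ∀ {b u v} → adj G u v ≡ b → adj G v u ≡ b
adj-sym {G} {u = u} {v} = trans (Graph.sym G v u)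

Uniform : Bool → Family
Uniform β G = ∀ u v → u ≢ v → adj G u v ≡ β

uniform-adj : Bool → Fin m → Fin m → Bool
uniform-adj β i j = if does (i ≟ j) then false else β

uniform : Bool → ℕ → Graph
uniform β m = mkGraph m (uniform-adj β) adj-sym′ adj-irr
  where
    adj-sym′ : ∀ i j → uniform-adj β i j ≡ uniform-adj β j i
    adj-sym′ i j with i ≟ j | j ≟ i
    ... | yes _ | yes _ = refl
    ... | no _  | no _  = refl
    ... | yes e | no ne = ⊥-elim (ne (sym e))
    ... | no ne | yes e = ⊥-elim (ne (sym e))
    adj-irr : ∀ i → uniform-adj β i i ≡ false
    adj-irr i with i ≟ i
    ... | yes _ = refl
    ... | no ne = ⊥-elim (ne refl)

uniform-isUniform : ∀ β m → Uniform β (uniform β m)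
uniform-isUniform β m i j i≢j with i ≟ j
... | yes i≡j = ⊥-elim (i≢j i≡j)
... | no _    = refl

Uniform-hereditary : Contains J K → Uniform β J → Uniform β K
Uniform-hereditary (f , f-inj , f-adj) unif u v u≢v =
  trans (f-adj u v) (unif (f u) (f v) (u≢v ∘ f-inj))

uniform-embedding : Uniform β K → (φ : Fin (n K) → Fin (n G)) → Injective _≡_ _≡_ φ →
  (∀ u v → u ≢ v → adj G (φ u) (φ v) ≡ β) → Contains G K
uniform-embedding {K = K} {G = G} unif φ φ-inj φ-adj = φ , φ-inj , adj-eq
  where
    adj-eq : ∀ u v → adj K u v ≡ adj G (φ u) (φ v)
    adj-eq u v with u ≟ v
    ... | yes refl = trans (irrfl K u) (sym (irrfl G (φ u)))
    ... | no u≢v   = trans (unif u v u≢v) (sym (φ-adj u v u≢v))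

Uniform⇒⊆uniform : Uniform β K → n K ≤ m → Contains (uniform β m) K
Uniform⇒⊆uniform {β} {K} {m} unif le =
  uniform-embedding {K = K} {G = uniform β m} unif (λ u → inject≤ u le) (inject≤-injective le le _ _)
    (λ u v u≢v → uniform-isUniform β m _ _ (u≢v ∘ inject≤-injective le le u v))

-- Ramsey's theorem

AllPairs-lookup : ∀ {R : A → A → Set} → (∀ {u v} → R u v → R v u) →
  ∀ {xs} → AllPairs R xs → ∀ {a b} → a ≢ b → R (lookup xs a) (lookup xs b)
AllPairs-lookup R-sym (px ∷ pxs) {zero}  {zero}  a≢b = ⊥-elim (a≢b refl)
AllPairs-lookup R-sym (px ∷ pxs) {zero}  {suc b} a≢b = All.lookup px (∈-lookup b)
AllPairs-lookup R-sym (px ∷ pxs) {suc a} {zero}  a≢b = R-sym (All.lookup px (∈-lookup a))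
AllPairs-lookup R-sym (px ∷ pxs) {suc a} {suc b} a≢b = AllPairs-lookup R-sym pxs (a≢b ∘ cong suc)

lookup-injective : ∀ {xs : List A} → Unique xs → Injective _≡_ _≡_ (lookup xs)
lookup-injective uniq {a} {b} eq with a ≟ b
... | yes a≡b = a≡b
... | no a≢b  = ⊥-elim (AllPairs-lookup (λ u≢v → u≢v ∘ sym) uniq a≢b eq)

Unique⇒injection : ∀ {P : A → Set} (ys : List A) → Unique ys → All P ys → m ≤ length ys →
  Σ (Fin m → A) λ ι → Injective _≡_ _≡_ ι × (∀ j → P (ι j))
Unique⇒injection ys uniq pys le =
  (λ j → lookup ys (inject≤ j le)) , inject≤-injective le le _ _ ∘ lookup-injective uniq ,
  λ j → All.lookup pys (∈-lookup _)

≤-+-pigeonhole : ∀ a b p q → a + b ≤ p + q → a ≤ p ⊎ b ≤ q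
≤-+-pigeonhole a b p q le with a ≤? p
... | yes a≤p = inj₁ a≤p
... | no a≰p  = inj₂ (+-cancelˡ-≤ (suc p) b q
                  (≤-trans (+-monoˡ-≤ b (≰⇒> a≰p)) (≤-trans le (n≤1+n (p + q)))))

length-filter-≟ : (f : A → Bool) (xs : List A) →
  length (filter (λ x → f x ≟ᵇ true) xs) + length (filter (λ x → f x ≟ᵇ false) xs) ≡ length xs
length-filter-≟ f [] = refl
length-filter-≟ f (x ∷ xs) with f x
... | true  = cong suc (length-filter-≟ f xs)
... | false = trans (+-suc _ _) (cong suc (length-filter-≟ f xs))

ramseyBound : ℕ → ℕ → ℕ
ramseyBound zero    b       = 0
ramseyBound (suc a) zero    = 0
ramseyBound (suc a) (suc b) = suc (ramseyBound a (suc b) + ramseyBound (suc a) b)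

UniformSublist : (G : Graph) → Bool → ℕ → List (Fin (n G)) → Set
UniformSublist G β m xs =
  Σ (List (Fin (n G))) λ ys →
    ys ⊆ xs × Unique ys × AllPairs (λ u v → adj G u v ≡ β) ys × m ≤ length ys

module _ {G : Graph} where

  neighbours : Bool → Fin (n G) → List (Fin (n G)) → List (Fin (n G))
  neighbours β v = filter (λ u → adj G v u ≟ᵇ β)

  UniformSublist-weaken : ∀ {v xs} → UniformSublist G β m (neighbours β′ v xs) →
    UniformSublist G β m (v ∷ xs)
  UniformSublist-weaken {v = v} {xs} (ys , ys⊆ , uniq , unif , len) =
    ys , there ∘ filter-⊆ _ xs ∘ ys⊆ , uniq , unif , len

  UniformSublist-extend : ∀ {v xs} → All (v ≢_) xs → UniformSublist G β m (neighbours β v xs) →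
    UniformSublist G β (suc m) (v ∷ xs)
  UniformSublist-extend {v = v} {xs} v∉xs (ys , ys⊆ , uniq , unif , len) =
    v ∷ ys
    , (λ { (here refl) → here refl ; (there y∈ys) → there (filter-⊆ _ xs (ys⊆ y∈ys)) })
    , All-resp-⊇ (filter-⊆ _ xs ∘ ys⊆) v∉xs ∷ uniq
    , All-resp-⊇ ys⊆ (all-filter _ xs) ∷ unif
    , s≤s len

  ramsey-sublist : ∀ a b xs → Unique xs → ramseyBound a b ≤ length xs →
    UniformSublist G true a xs ⊎ UniformSublist G false b xs
  ramsey-sublist zero    b       xs _ _ = inj₁ ([] , (λ ()) , [] , [] , z≤n)
  ramsey-sublist (suc a) zero    xs _ _ = inj₂ ([] , (λ ()) , [] , [] , z≤n)
  ramsey-sublist (suc a) (suc b) (v ∷ xs) (v∉xs ∷ uniq) (s≤s le)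
    with ≤-+-pigeonhole _ _ _ _ (≤-trans le (≤-reflexive (sym (length-filter-≟ (adj G v) xs))))
  ... | inj₁ large = Sum.map (UniformSublist-extend v∉xs) UniformSublist-weaken
                       (ramsey-sublist a (suc b) _ (AllPairs.filter⁺ _ uniq) large)
  ... | inj₂ large = Sum.map UniformSublist-weaken (UniformSublist-extend v∉xs)
                       (ramsey-sublist (suc a) b _ (AllPairs.filter⁺ _ uniq) large)

UniformSublist⇒contains : ∀ {xs} → UniformSublist G β m xs → Contains G (uniform β m)
UniformSublist⇒contains {G = G} {β = β} {m = m} (ys , _ , uniq , unif , len) =
  uniform-embedding {K = uniform β m} {G = G} (uniform-isUniform β m) (λ j → lookup ys (inject≤ j len))
    (inject≤-injective len len _ _ ∘ lookup-injective uniq)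
    (λ i j i≢j → AllPairs-lookup (adj-sym {G}) unif (i≢j ∘ inject≤-injective len len i j))

ramsey : ∀ a b → ramseyBound a b ≤ n G → Contains G (uniform true a) ⊎ Contains G (uniform false b)
ramsey {G} a b le =
  Sum.map (UniformSublist⇒contains {G}) (UniformSublist⇒contains {G})
    (ramsey-sublist {G} a b (allFin (n G)) (allFin⁺ (n G))
      (≤-trans le (≤-reflexive (sym (length-tabulate id)))))

-- Induced subgraphs on decidable vertex sets

InducedIn-map : (∀ K → 𝒢 K → n K ≤ n G → 𝒢′ K) → ∀ {X} → InducedIn G X 𝒢 → InducedIn G X 𝒢′
InducedIn-map 𝒢⊆𝒢′ (K , 𝒢K , f , f-inj , rest) = K , 𝒢⊆𝒢′ K 𝒢K (injective⇒≤ f-inj) , f , f-inj , rest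

InducedIn-pairwise : ∀ {X} → InducedIn G X (Uniform β) → ∀ u v → X u → X v → u ≢ v → adj G u v ≡ β
InducedIn-pairwise (K , unif , f , f-inj , _ , f-onto , f-adj) u v Xu Xv u≢v
  with f-onto u Xu | f-onto v Xv
... | a , refl | b , refl = trans (sym (f-adj a b)) (unif a b (u≢v ∘ cong f))

induced : (G : Graph) → List (Fin (n G)) → Graph
induced G xs = mkGraph _ (λ a b → adj G (lookup xs a) (lookup xs b))
  (λ a b → Graph.sym G (lookup xs a) (lookup xs b)) (λ a → irrfl G (lookup xs a))

restrict : (G : Graph) {X : VSet G} → Decidable X → Graph
restrict G X? = induced G (filter X? (allFin (n G)))

restrict-embedding : ∀ G {X} (X? : Decidable X) → Contains G (restrict G X?)
restrict-embedding G X? = lookup xs , lookup-injective (Unique.filter⁺ X? (allFin⁺ (n G))) , λ _ _ → refl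
  where
    xs : List (Fin (n G))
    xs = filter X? (allFin (n G))

restrict-⊆ : ∀ G {X} (X? : Decidable X) a → X (proj₁ (restrict-embedding G X?) a)
restrict-⊆ G X? a = All.lookup (all-filter X? (allFin (n G))) (∈-lookup a)

InducedIn-restrict : ∀ G {X} (X? : Decidable X) → 𝒢 (restrict G X?) → InducedIn G X 𝒢
InducedIn-restrict G X? 𝒢G =
  restrict G X? , 𝒢G , proj₁ (restrict-embedding G X?) , proj₁ (proj₂ (restrict-embedding G X?))
  , restrict-⊆ G X?
  , (λ v Xv → let v∈xs = ∈-filter⁺ X? (∈-allFin v) Xv in index v∈xs , sym (lookup-index v∈xs))
  , (λ _ _ → refl)

pairwise⇒InducedIn-Uniform : ∀ G {X} → Decidable X → (∀ u v → X u → X v → u ≢ v → adj G u v ≡ β) →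
  InducedIn G X (Uniform β)
pairwise⇒InducedIn-Uniform G X? pairwise =
  InducedIn-restrict G X? λ a b a≢b →
    pairwise _ _ (restrict-⊆ G X? a) (restrict-⊆ G X? b) (a≢b ∘ proj₁ (proj₂ (restrict-embedding G X?)))

InducedIn-ι-contains : ∀ {X L} → InducedIn G X (ι J) → ((φ , _) : Contains G L) → (∀ a → X (φ a)) →
  Contains J L
InducedIn-ι-contains {G} {J} {L = L} (K , J⊇K , f , f-inj , _ , f-onto , f-adj) (φ , φ-inj , φ-adj) inX =
  contains-trans {J} {K} {L} J⊇K (ψ , ψ-inj , ψ-adj)
  where
    ψ : Fin (n L) → Fin (n K)
    ψ a = proj₁ (f-onto (φ a) (inX a))
    fψ : ∀ a → f (ψ a) ≡ φ a
    fψ a = proj₂ (f-onto (φ a) (inX a))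
    ψ-inj : ∀ {a b} → ψ a ≡ ψ b → a ≡ b
    ψ-inj {a} {b} eq = φ-inj (trans (sym (fψ a)) (trans (cong f eq) (fψ b)))
    ψ-adj : ∀ a b → adj L a b ≡ adj K (ψ a) (ψ b)
    ψ-adj a b =
      trans (φ-adj a b) (trans (cong₂ (adj G) (sym (fψ a)) (sym (fψ b))) (sym (f-adj (ψ a) (ψ b))))

-- Cones and two-apex graphs

cone-adj : (G : Graph) → (Fin (n G) → Bool) → Fin (suc (n G)) → Fin (suc (n G)) → Bool
cone-adj G f zero    zero    = false
cone-adj G f zero    (suc v) = f v
cone-adj G f (suc u) zero    = f u
cone-adj G f (suc u) (suc v) = adj G u v

cone : (G : Graph) → (Fin (n G) → Bool) → Graph
cone G f = mkGraph (suc (n G)) (cone-adj G f) cone-sym cone-irr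
  where
    cone-sym : ∀ u v → cone-adj G f u v ≡ cone-adj G f v u
    cone-sym zero    zero    = refl
    cone-sym zero    (suc v) = refl
    cone-sym (suc u) zero    = refl
    cone-sym (suc u) (suc v) = Graph.sym G u v
    cone-irr : ∀ v → cone-adj G f v v ≡ false
    cone-irr zero    = refl
    cone-irr (suc v) = irrfl G v

cone-contains : ∀ {f} ((φ , _) : Contains K G) (x : Fin (n K)) →
  (∀ v → φ v ≢ x) → (∀ v → adj K x (φ v) ≡ f v) → Contains K (cone G f)
cone-contains {K} {G} {f} (φ , φ-inj , φ-adj) x φ≢x x-adj = ψ , ψ-inj , ψ-adj
  where
    ψ : Fin (n (cone G f)) → Fin (n K)
    ψ zero    = x
    ψ (suc v) = φ v
    ψ-inj : ∀ {u v} → ψ u ≡ ψ v → u ≡ v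
    ψ-inj {zero}  {zero}  _  = refl
    ψ-inj {zero}  {suc v} eq = ⊥-elim (φ≢x v (sym eq))
    ψ-inj {suc u} {zero}  eq = ⊥-elim (φ≢x u eq)
    ψ-inj {suc u} {suc v} eq = cong suc (φ-inj eq)
    ψ-adj : ∀ u v → adj (cone G f) u v ≡ adj K (ψ u) (ψ v)
    ψ-adj zero    zero    = sym (irrfl K x)
    ψ-adj zero    (suc v) = sym (x-adj v)
    ψ-adj (suc u) zero    = sym (adj-sym {K} (x-adj u))
    ψ-adj (suc u) (suc v) = φ-adj u v

-- Vertices 0 and 1 are apexes over a clique of size m, adjacent to it by α and β and to
-- each other by γ.
twoApex : Bool → Bool → Bool → ℕ → Graph
twoApex α β γ m = cone (cone (uniform true m) (const β)) (γ Vector.∷ const α)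

twoApex-contains : ((φ , _) : Contains K (uniform true m)) {x y : Fin (n K)} →
  x ≢ y → adj K x y ≡ γ →
  (∀ j → φ j ≢ x × adj K x (φ j) ≡ α) → (∀ j → φ j ≢ y × adj K y (φ j) ≡ β) →
  Contains K (twoApex α β γ m)
twoApex-contains {K} {m} {γ} {α} {β} e {x} {y} x≢y xy-adj x-clique y-clique =
  cone-contains {K = K} {f = γ Vector.∷ const α}
    (cone-contains {K = K} {f = const β} e y (proj₁ ∘ y-clique) (proj₂ ∘ y-clique)) x
    (λ { zero → x≢y ∘ sym ; (suc j) → proj₁ (x-clique j) })
    (λ { zero → xy-adj ; (suc j) → proj₂ (x-clique j) })

data Role : Set where
  apex₁ apex₂ base : Role

record TwoApexShape (α β γ : Bool) (K : Graph) : Set where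
  field
    role         : Fin (n K) → Role
    apex₁-unique : ∀ {u v} → role u ≡ apex₁ → role v ≡ apex₁ → u ≡ v
    apex₂-unique : ∀ {u v} → role u ≡ apex₂ → role v ≡ apex₂ → u ≡ v
    base-clique  : ∀ {u v} → role u ≡ base → role v ≡ base → u ≢ v → adj K u v ≡ true
    apex₁-base   : ∀ {u v} → role u ≡ apex₁ → role v ≡ base → adj K u v ≡ α
    apex₂-base   : ∀ {u v} → role u ≡ apex₂ → role v ≡ base → adj K u v ≡ β
    apex₁-apex₂  : ∀ {u v} → role u ≡ apex₁ → role v ≡ apex₂ → adj K u v ≡ γ

TwoApexShape⇒contains : TwoApexShape α β γ K → n K ≤ m → Contains (twoApex α β γ m) K
TwoApexShape⇒contains {α} {β} {γ} {K} {m} shape le = φ , φ-inj , φ-adj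
  where
    open TwoApexShape shape
    place : Role → Fin (n K) → Fin (n (twoApex α β γ m))
    place apex₁ _ = zero
    place apex₂ _ = suc zero
    place base  u = suc (suc (inject≤ u le))
    φ : Fin (n K) → Fin (n (twoApex α β γ m))
    φ u = place (role u) u
    φ-inj : ∀ {u v} → φ u ≡ φ v → u ≡ v
    φ-inj {u} {v} eq with role u in ru | role v in rv
    ... | apex₁ | apex₁ = apex₁-unique ru rv
    ... | apex₂ | apex₂ = apex₂-unique ru rv
    ... | base  | base  = inject≤-injective le le u v (suc-injective (suc-injective eq))
    φ-inj () | apex₁ | apex₂
    φ-inj () | apex₁ | base
    φ-inj () | apex₂ | apex₁
    φ-inj () | apex₂ | base
    φ-inj () | base  | apex₁
    φ-inj () | base  | apex₂
    base-adj : ∀ {u v} → role u ≡ base → role v ≡ base →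
      adj K u v ≡ adj (uniform true m) (inject≤ u le) (inject≤ v le)
    base-adj {u} {v} ru rv with u ≟ v
    ... | yes refl = trans (irrfl K u) (sym (irrfl (uniform true m) (inject≤ u le)))
    ... | no u≢v   = trans (base-clique ru rv u≢v)
                       (sym (uniform-isUniform true m _ _ (u≢v ∘ inject≤-injective le le u v)))
    φ-adj : ∀ u v → adj K u v ≡ adj (twoApex α β γ m) (φ u) (φ v)
    φ-adj u v with role u in ru | role v in rv
    ... | apex₁ | apex₁ rewrite apex₁-unique ru rv = irrfl K v
    ... | apex₂ | apex₂ rewrite apex₂-unique ru rv = irrfl K v
    ... | base  | base  = base-adj ru rv
    ... | apex₁ | apex₂ = apex₁-apex₂ ru rv
    ... | apex₂ | apex₁ = adj-sym {K} (apex₁-apex₂ rv ru)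
    ... | apex₁ | base  = apex₁-base ru rv
    ... | base  | apex₁ = adj-sym {K} (apex₁-base rv ru)
    ... | apex₂ | base  = apex₂-base ru rv
    ... | base  | apex₂ = adj-sym {K} (apex₂-base rv ru)

Cplus⇒TwoApexShape : Cplus K → TwoApexShape false true true K
Cplus⇒TwoApexShape (inj₁ complete) = record
  { role = const base ; apex₁-unique = λ () ; apex₂-unique = λ ()
  ; base-clique = λ {u} {v} _ _ → complete u v
  ; apex₁-base = λ () ; apex₂-base = λ () ; apex₁-apex₂ = λ () }
Cplus⇒TwoApexShape {K} (inj₂ (w , deg≤1 , rest-complete)) = record
  { role = role
  ; apex₁-unique = λ ru rv → trans (role-apex₁ ru) (sym (role-apex₁ rv))
  ; apex₂-unique = λ ru rv → deg≤1 _ _ (proj₂ (role-apex₂ ru)) (proj₂ (role-apex₂ rv))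
  ; base-clique = λ ru rv → rest-complete _ _ (proj₁ (role-base ru)) (proj₁ (role-base rv))
  ; apex₁-base = λ {u} ru rv → trans (cong (λ x → adj K x _) (role-apex₁ ru)) (proj₂ (role-base rv))
  ; apex₂-base = apex₂-base
  ; apex₁-apex₂ = λ {u} ru rv → trans (cong (λ x → adj K x _) (role-apex₁ ru)) (proj₂ (role-apex₂ rv)) }
  where
    role : Fin (n K) → Role
    role u with u ≟ w | adj K w u
    ... | yes _ | _     = apex₁
    ... | no _  | true  = apex₂
    ... | no _  | false = base
    role-apex₁ : ∀ {u} → role u ≡ apex₁ → u ≡ w
    role-apex₁ {u} r with u ≟ w | adj K w u
    ... | yes u≡w | _ = u≡w
    role-apex₁ () | no _ | true
    role-apex₁ () | no _ | false
    role-apex₂ : ∀ {u} → role u ≡ apex₂ → u ≢ w × adj K w u ≡ true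
    role-apex₂ {u} r with u ≟ w | adj K w u
    role-apex₂ () | yes _ | _
    ... | no u≢w | true = u≢w , refl
    role-apex₂ () | no _ | false
    role-base : ∀ {u} → role u ≡ base → u ≢ w × adj K w u ≡ false
    role-base {u} r with u ≟ w | adj K w u
    role-base () | yes _ | _
    role-base () | no _ | true
    ... | no u≢w | false = u≢w , refl
    apex₂-base : ∀ {u v} → role u ≡ apex₂ → role v ≡ base → adj K u v ≡ true
    apex₂-base {u} {v} ru rv with role-apex₂ ru | role-base rv
    ... | u≢w , wu | v≢w , wv = rest-complete u v u≢w v≢w λ { refl → true≢false (trans (sym wu) wv) }

apexRole : Fin 2 → Role
apexRole zero       = apex₁
apexRole (suc zero) = apex₂

apexRole-injective : ∀ {a b} → apexRole a ≡ apexRole b → a ≡ b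
apexRole-injective {zero}     {zero}     _ = refl
apexRole-injective {suc zero} {suc zero} _ = refl
apexRole-injective {zero}     {suc zero} ()
apexRole-injective {suc zero} {zero}     ()

apexRole≢base : ∀ a → apexRole a ≢ base
apexRole≢base zero       ()
apexRole≢base (suc zero) ()

module SlotRoles {K : Graph} (A : Fin (n K) → Bool) (slot : ∀ u → A u ≡ true → Fin 2) where

  private
    -- Abstracting over the equation A u ≡ b lets the role be analysed by matching on b,
    -- which a with-abstraction over A u cannot do since slot depends on the proof.
    roleOf : ∀ u {b} → A u ≡ b → Role
    roleOf u {true}  Au = apexRole (slot u Au)
    roleOf u {false} _  = base

    roleOf-base : ∀ {u b} (Au : A u ≡ b) → roleOf u Au ≡ base → A u ≡ false
    roleOf-base {b = true}  Au r = ⊥-elim (apexRole≢base _ r)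
    roleOf-base {b = false} Au _ = Au

    roleOf-apex : ∀ {u b r} (Au : A u ≡ b) → r ≢ base → roleOf u Au ≡ r →
      Σ (A u ≡ true) λ Au → apexRole (slot u Au) ≡ r
    roleOf-apex {b = true}  Au _      r = Au , r
    roleOf-apex {b = false} _  r≢base r = ⊥-elim (r≢base (sym r))

  slotRole : Fin (n K) → Role
  slotRole u = roleOf u refl

  slotRole-base : ∀ {u} → slotRole u ≡ base → A u ≡ false
  slotRole-base = roleOf-base refl

  slotRole-apex : ∀ {u r} → r ≢ base → slotRole u ≡ r → Σ (A u ≡ true) λ Au → apexRole (slot u Au) ≡ r
  slotRole-apex = roleOf-apex refl

apexUnion⇒TwoApexShape : (A : Fin (n K) → Bool) →
  InducedIn K (λ v → A v ≡ true) (λ J → Uniform γ J × n J ≤ 2) →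
  InducedIn K (λ v → A v ≡ false) Complete →
  (∀ u v → A u ≡ true → A v ≡ false → adj K u v ≡ δ) → TwoApexShape δ δ γ K
apexUnion⇒TwoApexShape {K} {γ} {δ} A apexes@(J , (_ , J≤2) , f , f-inj , _ , f-onto , _) bases cross =
  record
  { role = slotRole
  ; apex₁-unique = apex-unique (λ ())
  ; apex₂-unique = apex-unique (λ ())
  ; base-clique = λ ru rv → InducedIn-pairwise {G = K} bases _ _ (slotRole-base ru) (slotRole-base rv)
  ; apex₁-base = λ ru rv → cross _ _ (proj₁ (slotRole-apex (λ ()) ru)) (slotRole-base rv)
  ; apex₂-base = λ ru rv → cross _ _ (proj₁ (slotRole-apex (λ ()) ru)) (slotRole-base rv)
  ; apex₁-apex₂ = apex₁-apex₂ }
  where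
    slot : ∀ u → A u ≡ true → Fin 2
    slot u Au = inject≤ (proj₁ (f-onto u Au)) J≤2
    open SlotRoles {K} A slot
    slot-injective : ∀ {u v} Au Av → slot u Au ≡ slot v Av → u ≡ v
    slot-injective {u} {v} Au Av eq with f-onto u Au | f-onto v Av
    ... | a , refl | b , refl = cong f (inject≤-injective J≤2 J≤2 a b eq)
    apex-unique : ∀ {u v r} → r ≢ base → slotRole u ≡ r → slotRole v ≡ r → u ≡ v
    apex-unique r≢base ru rv with slotRole-apex r≢base ru | slotRole-apex r≢base rv
    ... | Au , su | Av , sv = slot-injective Au Av (apexRole-injective (trans su (sym sv)))
    apex₁-apex₂ : ∀ {u v} → slotRole u ≡ apex₁ → slotRole v ≡ apex₂ → adj K u v ≡ γ
    apex₁-apex₂ {u} {v} ru rv =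
      InducedIn-pairwise {G = K} (InducedIn-map {G = K} (λ _ unif _ → proj₁ unif) apexes) u v
        (proj₁ (slotRole-apex (λ ()) ru)) (proj₁ (slotRole-apex (λ ()) rv))
        λ { refl → apex₁≢apex₂ (trans (sym ru) rv) }
      where
        apex₁≢apex₂ : apex₁ ≢ apex₂
        apex₁≢apex₂ ()

ι-Uniform-≤2 : ∀ J → Uniform γ J → n J ≤ 2 → ∀ K → ι J K → n K ≤ n G → Uniform γ K × n K ≤ 2
ι-Uniform-≤2 J unif J≤2 K J⊇K _ =
  Uniform-hereditary {J = J} {K = K} J⊇K unif , ≤-trans (injective⇒≤ (proj₁ (proj₂ J⊇K))) J≤2

∨F⇒TwoApexShape : ∀ J → Uniform γ J → n J ≤ 2 → (ι J ∨F Complete) K → TwoApexShape false false γ K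
∨F⇒TwoApexShape {K = K} J unif J≤2 (A , apexes , bases , cross) =
  apexUnion⇒TwoApexShape A (InducedIn-map {G = K} (ι-Uniform-≤2 {G = K} J unif J≤2) apexes) bases cross

∧F⇒TwoApexShape : ∀ J → Uniform γ J → n J ≤ 2 → (ι J ∧F Complete) K → TwoApexShape true true γ K
∧F⇒TwoApexShape {K = K} J unif J≤2 (A , apexes , bases , cross) =
  apexUnion⇒TwoApexShape A (InducedIn-map {G = K} (ι-Uniform-≤2 {G = K} J unif J≤2) apexes) bases cross

S₂-uniform : Uniform false S₂
S₂-uniform _ _ _ = refl

K₂-uniform : Uniform true K₂
K₂-uniform zero       zero       0≢0 = ⊥-elim (0≢0 refl)
K₂-uniform zero       (suc zero) _   = refl
K₂-uniform (suc zero) zero       _   = refl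
K₂-uniform (suc zero) (suc zero) 1≢1 = ⊥-elim (1≢1 refl)

-- Partitions into stable sets and cliques

InH⁺ : Family → ℕ → ℕ → Family
InH⁺ 𝒢 s t G =
  Σ (Fin (n G) → Fin (suc (s + t))) λ c →
    InducedIn G (Part G c zero) 𝒢
    × (∀ (i : Fin s) → StablePart G (Part G c (suc (i ↑ˡ t))))
    × (∀ (j : Fin t) → CliquePart G (Part G c (suc (s ↑ʳ j))))

Part-relabel : ∀ {k k′} {c : Fin (n G) → Fin k} (r : Fin k → Fin k′) (r⁻ : Fin k′ → Fin k) →
  (∀ j → r⁻ (r j) ≡ j) → ∀ {j v} → Part G (r ∘ c) j v → Part G c (r⁻ j) v
Part-relabel {c = c} r r⁻ r⁻∘r {v = v} eq = trans (sym (r⁻∘r (c v))) (cong r⁻ eq)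

↑ʳ≢↑ˡ : ∀ {s t} (j : Fin t) (i : Fin s) → s ↑ʳ j ≢ i ↑ˡ t
↑ʳ≢↑ˡ {s} {t} j i eq with trans (sym (splitAt-↑ʳ s t j)) (trans (cong (splitAt s) eq) (splitAt-↑ˡ s i t))
... | ()

InH-mono : s ≤ s′ → t ≤ t′ → InH s t G → InH s′ t′ G
InH-mono {s} {s′} {t} {t′} {G} s≤s′ t≤t′ (c , stable , clique) = r ∘ c , stable′ , clique′
  where
    r : Fin (s + t) → Fin (s′ + t′)
    r = join s′ t′ ∘ Sum.map (λ i → inject≤ i s≤s′) (λ j → inject≤ j t≤t′) ∘ splitAt s
    r-stable : ∀ k i′ → r k ≡ i′ ↑ˡ t′ → Σ (Fin s) λ i → i ↑ˡ t ≡ k × inject≤ i s≤s′ ≡ i′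
    r-stable k i′ eq with splitAt s k in split
    ... | inj₁ i = i , splitAt⁻¹-↑ˡ split , ↑ˡ-injective t′ _ _ eq
    ... | inj₂ j = ⊥-elim (↑ʳ≢↑ˡ _ _ eq)
    r-clique : ∀ k j′ → r k ≡ s′ ↑ʳ j′ → Σ (Fin t) λ j → s ↑ʳ j ≡ k × inject≤ j t≤t′ ≡ j′
    r-clique k j′ eq with splitAt s k in split
    ... | inj₁ i = ⊥-elim (↑ʳ≢↑ˡ _ _ (sym eq))
    ... | inj₂ j = j , splitAt⁻¹-↑ʳ split , ↑ʳ-injective s′ _ _ eq
    stable′ : ∀ i′ → StablePart G (Part G (r ∘ c) (i′ ↑ˡ t′))
    stable′ i′ u v ru rv with r-stable (c u) i′ ru | r-stable (c v) i′ rv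
    ... | i , eu , iu | i₂ , ev , i₂v with inject≤-injective s≤s′ s≤s′ i i₂ (trans iu (sym i₂v))
    ... | refl = stable i u v (sym eu) (sym ev)
    clique′ : ∀ j′ → CliquePart G (Part G (r ∘ c) (s′ ↑ʳ j′))
    clique′ j′ u v ru rv with r-clique (c u) j′ ru | r-clique (c v) j′ rv
    ... | j , eu , ju | j₂ , ev , j₂v with inject≤-injective t≤t′ t≤t′ j j₂ (trans ju (sym j₂v))
    ... | refl = clique j u v (sym eu) (sym ev)

InH⇒InH⁺-stable : InH (suc s) t G → InH⁺ (Uniform false) s t G
InH⇒InH⁺-stable {G = G} (c , stable , clique) =
  c , pairwise⇒InducedIn-Uniform G (λ v → c v ≟ zero) (λ u v cu cv _ → stable zero u v cu cv)
  , stable ∘ suc , clique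

-- Moves the first clique s ↑ʳ zero to the front, shifting the stable parts up by one.
cliqueToFront : ∀ s {t} → Fin (s + suc t) → Fin (suc (s + t))
cliqueToFront zero    k       = k
cliqueToFront (suc s) zero    = suc zero
cliqueToFront (suc s) (suc k) = lift 1 suc (cliqueToFront s k)

cliqueToFront⁻ : ∀ s {t} → Fin (suc (s + t)) → Fin (s + suc t)
cliqueToFront⁻ zero    k             = k
cliqueToFront⁻ (suc s) zero          = suc (cliqueToFront⁻ s zero)
cliqueToFront⁻ (suc s) (suc zero)    = zero
cliqueToFront⁻ (suc s) (suc (suc k)) = suc (cliqueToFront⁻ s (suc k))

cliqueToFront-inverse : ∀ s {t} k → cliqueToFront⁻ s {t} (cliqueToFront s k) ≡ k
cliqueToFront-inverse zero    k       = refl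
cliqueToFront-inverse (suc s) zero    = refl
cliqueToFront-inverse (suc s) (suc k) with cliqueToFront s k | cliqueToFront-inverse s k
... | zero  | eq = cong suc eq
... | suc _ | eq = cong suc eq

cliqueToFront⁻-zero : ∀ s {t} → cliqueToFront⁻ s {t} zero ≡ s ↑ʳ zero
cliqueToFront⁻-zero zero    = refl
cliqueToFront⁻-zero (suc s) = cong suc (cliqueToFront⁻-zero s)

cliqueToFront⁻-↑ˡ : ∀ {s t} (i : Fin s) → cliqueToFront⁻ s (suc (i ↑ˡ t)) ≡ i ↑ˡ suc t
cliqueToFront⁻-↑ˡ zero    = refl
cliqueToFront⁻-↑ˡ (suc i) = cong suc (cliqueToFront⁻-↑ˡ i)

cliqueToFront⁻-↑ʳ : ∀ s {t} (j : Fin t) → cliqueToFront⁻ s (suc (s ↑ʳ j)) ≡ s ↑ʳ suc j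
cliqueToFront⁻-↑ʳ zero    j = refl
cliqueToFront⁻-↑ʳ (suc s) j = cong suc (cliqueToFront⁻-↑ʳ s j)

InH⇒InH⁺-clique : InH s (suc t) G → InH⁺ (Uniform true) s t G
InH⇒InH⁺-clique {s} {t} {G} (c , stable , clique) =
  c′ , pairwise⇒InducedIn-Uniform G (λ v → c′ v ≟ zero) (from (clique zero) (cliqueToFront⁻-zero s))
  , (λ i → from (stable i) (cliqueToFront⁻-↑ˡ i))
  , (λ j → from (clique (suc j)) (cliqueToFront⁻-↑ʳ s j))
  where
    c′ : Fin (n G) → Fin (suc (s + t))
    c′ = cliqueToFront s ∘ c
    from : ∀ {R : Fin (n G) → Fin (n G) → Set} {j k} → (∀ u v → c u ≡ k → c v ≡ k → R u v) →
      cliqueToFront⁻ s j ≡ k → ∀ u v → c′ u ≡ j → c′ v ≡ j → R u v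
    from pairwise refl u v cu cv = pairwise u v (back cu) (back cv)
      where
        back : ∀ {j v} → c′ v ≡ j → c v ≡ cliqueToFront⁻ s j
        back = Part-relabel {G} {c = c} (cliqueToFront s) (cliqueToFront⁻ s) (cliqueToFront-inverse s)

InducedIn-resp : ∀ {X Y : VSet G} → (∀ v → X v → Y v) → (∀ v → Y v → X v) →
  InducedIn G X 𝒢 → InducedIn G Y 𝒢
InducedIn-resp X⊆Y Y⊆X (K , 𝒢K , f , f-inj , f-in , f-onto , f-adj) =
  K , 𝒢K , f , f-inj , (λ a → X⊆Y _ (f-in a)) , (λ v Yv → f-onto v (Y⊆X v Yv)) , f-adj

CliquesPlus⇒InH⁺ : CliquesPlus (suc t) 𝒢 G → InH⁺ 𝒢 0 t G
CliquesPlus⇒InH⁺ {t} {𝒢} {G} (c , i , special , clique) =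
  c′ , InducedIn-resp {G} (λ _ ci → trans (cong (Perm.transpose i zero) ci) (Perm.transpose-inverse i zero))
         (λ _ → back) special
  , (λ ()) , clique′
  where
    c′ : Fin (n G) → Fin (suc t)
    c′ = Perm.transpose i zero ∘ c
    back : ∀ {j v} → c′ v ≡ j → c v ≡ Perm.transpose zero i j
    back = Part-relabel {G} {c = c} (Perm.transpose i zero) (Perm.transpose zero i)
             (λ _ → Perm.transpose-inverse zero i)
    transpose≢i : ∀ j → Perm.transpose zero i (suc j) ≢ i
    transpose≢i j eq
      with trans (trans (sym (Perm.transpose-inverse i zero {suc j})) (cong (Perm.transpose i zero) eq))
                 (Perm.transpose-inverse i zero {zero})
    ... | ()
    clique′ : ∀ j → CliquePart G (Part G c′ (suc j))
    clique′ j u v cu cv = clique _ (transpose≢i j) u v (back cu) (back cv)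

InH⁺⇒CliquesPlus : InH⁺ 𝒢 0 t G → CliquesPlus (suc t) 𝒢 G
InH⁺⇒CliquesPlus (c , special , _ , clique) =
  c , zero , special , λ { zero 0≢0 → ⊥-elim (0≢0 refl) ; (suc j) _ → clique j }

StablePart-pullback : ((φ , _) : Contains G H) → ∀ {X} → StablePart G X → StablePart H (X ∘ φ)
StablePart-pullback (φ , _ , φ-adj) stable u v Xu Xv = trans (φ-adj u v) (stable _ _ Xu Xv)

CliquePart-pullback : ((φ , _) : Contains G H) → ∀ {X} → CliquePart G X → CliquePart H (X ∘ φ)
CliquePart-pullback (φ , φ-inj , φ-adj) clique u v Xu Xv u≢v =
  trans (φ-adj u v) (clique _ _ Xu Xv (u≢v ∘ φ-inj))

InH-hereditary : Contains G H → InH s t G → InH s t H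
InH-hereditary {G} {H} e (c , stable , clique) =
  c ∘ proj₁ e
  , (λ i → StablePart-pullback {G} {H} e (stable i)) , (λ j → CliquePart-pullback {G} {H} e (clique j))

InH⁺-ι-hereditary : Contains G H → InH⁺ (ι J) s t G → InH⁺ (ι J) s t H
InH⁺-ι-hereditary {G} {H} {J} e@(φ , _) (c , special , stable , clique) =
  c ∘ φ
  , InducedIn-restrict H Y? (InducedIn-ι-contains {G} {J} {L = restrict H Y?} special
                               (contains-trans {G} {H} {restrict H Y?} e (restrict-embedding H Y?))
                               (restrict-⊆ H Y?))
  , (λ i → StablePart-pullback {G} {H} e (stable i)) , (λ j → CliquePart-pullback {G} {H} e (clique j))
  where
    Y? : Decidable (λ v → c (φ v) ≡ zero)
    Y? v = c (φ v) ≟ zero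

CoBipartite : Family
CoBipartite K =
  Σ (Fin (n K) → Bool) λ A → CliquePart K (λ v → A v ≡ true) × CliquePart K (λ v → A v ≡ false)

∨K₂⇒CoBipartite : ∀ {K} → (ι K₂ ∨F Complete) K → CoBipartite K
∨K₂⇒CoBipartite {K} (A , apexes , bases , _) =
  A , InducedIn-pairwise {K} (InducedIn-map {G = K} (λ J K₂⊇J _ → Uniform-hereditary {K₂} {J} K₂⊇J K₂-uniform)
                                                   apexes)
    , InducedIn-pairwise {K} bases

InducedIn-CoBipartite : ∀ {X} → Decidable X → InducedIn G X CoBipartite →
  Σ (Fin (n G) → Bool) λ D →
    CliquePart G (λ v → X v × D v ≡ true) × CliquePart G (λ v → X v × D v ≡ false)
InducedIn-CoBipartite {G} {X} X? (K , (A , cliqueᵗ , cliqueᶠ) , f , f-inj , f-in , f-onto , f-adj) =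
  D , clique cliqueᵗ , clique cliqueᶠ
  where
    D : Fin (n G) → Bool
    D v with X? v
    ... | yes Xv = A (proj₁ (f-onto v Xv))
    ... | no _   = true
    D∘f : ∀ a → D (f a) ≡ A a
    D∘f a with X? (f a)
    ... | yes Xfa = cong A (f-inj (proj₂ (f-onto (f a) Xfa)))
    ... | no ¬Xfa = ⊥-elim (¬Xfa (f-in a))
    clique : ∀ {b} → CliquePart K (λ a → A a ≡ b) → CliquePart G (λ v → X v × D v ≡ b)
    clique cliqueᵇ u v (Xu , Du) (Xv , Dv) u≢v with f-onto u Xu | f-onto v Xv
    ... | a , refl | a′ , refl =
      trans (sym (f-adj a a′))
        (cliqueᵇ a a′ (trans (sym (D∘f a)) Du) (trans (sym (D∘f a′)) Dv) (u≢v ∘ cong f))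

module _ {l} {G : Graph} (c : Fin (n G) → Fin l) (i : Fin l) (D : Fin (n G) → Bool) where

  private
    data Placement (v : Fin (n G)) : Set where
      spilled : c v ≡ i → D v ≡ false → Placement v
      kept    : (c v ≡ i → D v ≡ true) → Placement v

    placement : ∀ v → Placement v
    placement v with c v ≟ i | D v in Dv
    ... | yes cv≡i | false = spilled cv≡i Dv
    ... | yes _    | true  = kept λ _ → Dv
    ... | no cv≢i  | _     = kept λ cv≡i → ⊥-elim (cv≢i cv≡i)

    place : ∀ v → Placement v → Fin (suc l)
    place v (spilled _ _) = zero
    place v (kept _)      = suc (c v)

  splitPart : Fin (n G) → Fin (suc l)
  splitPart v = place v (placement v)

  splitPart-cliques : (∀ j → j ≢ i → CliquePart G (Part G c j)) →
    CliquePart G (λ v → c v ≡ i × D v ≡ true) → CliquePart G (λ v → c v ≡ i × D v ≡ false) →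
    ∀ j → CliquePart G (Part G splitPart j)
  splitPart-cliques clique cliqueᵗ cliqueᶠ j u v pu pv u≢v with placement u | placement v
  ... | spilled cu Du | spilled cv Dv = cliqueᶠ u v (cu , Du) (cv , Dv) u≢v
  ... | spilled _ _   | kept _        = ⊥-elim (0≢1+n (trans pu (sym pv)))
  ... | kept _        | spilled _ _   = ⊥-elim (0≢1+n (trans pv (sym pu)))
  ... | kept ku       | kept kv with suc-injective (trans pu (sym pv)) | c u ≟ i
  ...   | cu≡cv | yes cu≡i = cliqueᵗ u v (cu≡i , ku cu≡i) (cv≡i , kv cv≡i) u≢v
    where
      cv≡i : c v ≡ i
      cv≡i = trans (sym cu≡cv) cu≡i
  ...   | cu≡cv | no cu≢i  = clique (c u) cu≢i u v refl (sym cu≡cv) u≢v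

CliquesPlus-CoBipartite⇒InH : ∀ {l} → CliquesPlus l CoBipartite G → InH 0 (suc l) G
CliquesPlus-CoBipartite⇒InH {G} (c , i , special , clique)
  with InducedIn-CoBipartite {G} (λ v → c v ≟ i) special
... | D , cliqueᵗ , cliqueᶠ =
  splitPart {G = G} c i D , (λ ()) , splitPart-cliques {G = G} c i D clique cliqueᵗ cliqueᶠ

InH⁺-map : (∀ K → 𝒢 K → n K ≤ n G → 𝒢′ K) → InH⁺ 𝒢 s t G → InH⁺ 𝒢′ s t G
InH⁺-map {G = G} 𝒢⊆𝒢′ (c , special , rest) = c , InducedIn-map {G = G} 𝒢⊆𝒢′ special , rest

CliquesPlus-map : ∀ {l} → (∀ K → 𝒢 K → n K ≤ n G → 𝒢′ K) → CliquesPlus l 𝒢 G → CliquesPlus l 𝒢′ G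
CliquesPlus-map {G = G} 𝒢⊆𝒢′ (c , i , special , clique) =
  c , i , InducedIn-map {G = G} 𝒢⊆𝒢′ special , clique

-- Large reduced graphs containing a big clique

module OneStarFromClique (K : Graph) (N : ℕ) (Q : Contains K (uniform true (N + N)))
  (¬∨S₂ : ¬ Contains K (twoApex false false false N))
  (¬∨K₂ : ¬ Contains K (twoApex false false true N))
  (¬∧S₂ : ¬ Contains K (twoApex true true false N))
  (¬C⁺  : ¬ Contains K (twoApex false true true N)) where

  q : Fin (N + N) → Fin (n K)
  q = proj₁ Q

  q-injective : ∀ {i j} → q i ≡ q j → i ≡ j
  q-injective = proj₁ (proj₂ Q)

  q-clique : ∀ {i j} → i ≢ j → adj K (q i) (q j) ≡ true
  q-clique {i} {j} i≢j = trans (sym (proj₂ (proj₂ Q) i j)) (uniform-isUniform true (N + N) i j i≢j)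

  twoApex-in-Q : ∀ {α β γ x y} (is : List (Fin (N + N))) → Unique is → N ≤ length is →
    x ≢ y → adj K x y ≡ γ →
    (∀ {i} → i List.∈ is → q i ≢ x × adj K x (q i) ≡ α) →
    (∀ {i} → i List.∈ is → q i ≢ y × adj K y (q i) ≡ β) → Contains K (twoApex α β γ N)
  twoApex-in-Q {x = x} {y} is uniq large x≢y xy x-apex y-apex
    with Unique⇒injection is uniq (All.tabulate id) large
  ... | ψ , ψ-inj , ψ∈is =
    twoApex-contains {K} clique x≢y xy (x-apex ∘ ψ∈is) (y-apex ∘ ψ∈is)
    where
      clique : Contains K (uniform true N)
      clique = uniform-embedding {K = uniform true N} {G = K} (uniform-isUniform true N) (q ∘ ψ)
                 (ψ-inj ∘ q-injective) (λ a b a≢b → q-clique (a≢b ∘ ψ-inj))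

  N≤∣Q∣ : N ≤ length (allFin (N + N))
  N≤∣Q∣ = ≤-trans (m≤m+n N N) (≤-reflexive (sym (length-tabulate id)))

  Dominant : Fin (n K) → Set
  Dominant x = ∀ i → q i ≢ x → adj K x (q i) ≡ true

  dominant? : ∀ x → Dec (Dominant x)
  dominant? x = all? λ i → ¬? (q i ≟ x) →-dec (adj K x (q i) ≟ᵇ true)

  Q-dominant : ∀ {x i} → q i ≡ x → Dominant x
  Q-dominant refl j qj≢qi = q-clique λ { refl → qj≢qi refl }

  ¬dominant-outside : ∀ {x} → ¬ Dominant x → ∀ i → q i ≢ x
  ¬dominant-outside ¬dom i qi≡x = ¬dom (Q-dominant qi≡x)

  ¬dominant-misses : ∀ {x} → ¬ Dominant x → Σ (Fin (N + N)) λ i → adj K x (q i) ≡ false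
  ¬dominant-misses {x} ¬dom with ¬∀⟶∃¬ _ _ (λ i → ¬? (q i ≟ x) →-dec (adj K x (q i) ≟ᵇ true)) ¬dom
  ... | i , ¬edge with adj K x (q i) in e
  ...   | true  = ⊥-elim (¬edge λ _ → refl)
  ...   | false = i , e

  adjacency-separates : ∀ {x u v} → adj K x u ≡ true → adj K x v ≡ false → u ≢ v
  adjacency-separates xu xv refl = true≢false (trans (sym xu) xv)

  Q-apex : ∀ {y i j} → q j ≡ y → q i ≢ y → q i ≢ y × adj K y (q i) ≡ true
  Q-apex refl qi≢qj = qi≢qj , q-clique λ { refl → qi≢qj refl }

  splitQ : Bool → Fin (n K) → List (Fin (N + N))
  splitQ b x = filter (λ i → adj K x (q i) ≟ᵇ b) (allFin (N + N))

  splitQ-unique : ∀ b x → Unique (splitQ b x)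
  splitQ-unique b x = Unique.filter⁺ _ (allFin⁺ (N + N))

  splitQ-adj : ∀ {b x i} → i List.∈ splitQ b x → adj K x (q i) ≡ b
  splitQ-adj {b} {x} = proj₂ ∘ ∈-filter⁻ (λ i → adj K x (q i) ≟ᵇ b) {xs = allFin (N + N)}

  splitQ-large : ∀ x → N ≤ length (splitQ true x) ⊎ N ≤ length (splitQ false x)
  splitQ-large x = ≤-+-pigeonhole N N _ _
    (≤-trans (≤-reflexive (sym (length-tabulate id)))
      (≤-reflexive (sym (length-filter-≟ (adj K x ∘ q) (allFin (N + N))))))

  -- One of x's neighbourhood and non-neighbourhood in Q has N elements; with a
  -- non-neighbour, resp. a neighbour, of x in Q it yields ∧S₂, resp. 𝒞⁺.
  ¬dominant-isolated : ∀ {x} → ¬ Dominant x → ∀ i → adj K x (q i) ≡ false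
  ¬dominant-isolated {x} ¬dom i with adj K x (q i) in xqi | ¬dominant-misses ¬dom | splitQ-large x
  ... | false | _ | _ = refl
  ... | true | i₀ , xqi₀ | inj₁ large =
    ⊥-elim (¬∧S₂ (twoApex-in-Q (splitQ true x) (splitQ-unique true x) large
      (¬dominant-outside ¬dom i₀ ∘ sym) xqi₀
      (λ m → ¬dominant-outside ¬dom _ , splitQ-adj m)
      (λ m → Q-apex refl (adjacency-separates (splitQ-adj m) xqi₀))))
  ... | true | _ | inj₂ large =
    ⊥-elim (¬C⁺ (twoApex-in-Q (splitQ false x) (splitQ-unique false x) large
      (¬dominant-outside ¬dom i ∘ sym) xqi
      (λ m → ¬dominant-outside ¬dom _ , splitQ-adj m)
      (λ m → Q-apex refl (adjacency-separates xqi (splitQ-adj m) ∘ sym))))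

  ¬dominant-apex : ∀ {x} → ¬ Dominant x → ∀ i → q i ≢ x × adj K x (q i) ≡ false
  ¬dominant-apex ¬dom i = ¬dominant-outside ¬dom i , ¬dominant-isolated ¬dom i

  ¬twoIsolatedApexes : ∀ γ → ¬ Contains K (twoApex false false γ N)
  ¬twoIsolatedApexes false = ¬∨S₂
  ¬twoIsolatedApexes true  = ¬∨K₂

  ¬dominant-unique : ∀ {x y} → ¬ Dominant x → ¬ Dominant y → x ≡ y
  ¬dominant-unique {x} {y} ¬domx ¬domy with x ≟ y
  ... | yes x≡y = x≡y
  ... | no x≢y  = ⊥-elim (¬twoIsolatedApexes (adj K x y)
        (twoApex-in-Q (allFin (N + N)) (allFin⁺ _) N≤∣Q∣ x≢y refl
          (λ _ → ¬dominant-apex ¬domx _) (λ _ → ¬dominant-apex ¬domy _)))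

  dominant-clique : ∀ {x y} → Dominant x → Dominant y → x ≢ y → adj K x y ≡ true
  dominant-clique {x} {y} domx domy x≢y with adj K x y in xy
  ... | true  = refl
  ... | false = ⊥-elim (¬∧S₂ (twoApex-in-Q (allFin (N + N)) (allFin⁺ _) N≤∣Q∣ x≢y xy
                  (λ _ → apex domx domy (adj-sym {K} xy) x≢y) (λ _ → apex domy domx xy (x≢y ∘ sym))))
    where
      apex : ∀ {u v i} → Dominant u → Dominant v → adj K v u ≡ false → u ≢ v →
        q i ≢ u × adj K u (q i) ≡ true
      apex {u} {v} {i} domu domv vu u≢v = qi≢u , domu i qi≢u
        where
          qi≢u : q i ≢ u
          qi≢u refl = true≢false (trans (sym (domv i u≢v)) vu)

  ¬dominant-dominant : ∀ {x y} → ¬ Dominant x → Dominant y → adj K x y ≡ false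
  ¬dominant-dominant {x} {y} ¬domx domy with adj K x y in xy
  ... | false = refl
  ... | true  = ⊥-elim (¬C⁺ (twoApex-in-Q (allFin (N + N)) (allFin⁺ _) N≤∣Q∣ x≢y xy
                  (λ _ → ¬dominant-apex ¬domx _) (λ _ → qi≢y , domy _ qi≢y)))
    where
      x≢y : x ≢ y
      x≢y refl = true≢false (trans (sym xy) (irrfl K x))
      qi≢y : ∀ {i} → q i ≢ y
      qi≢y {i} refl = true≢false (trans (sym xy) (¬dominant-isolated ¬domx i))

  oneStar : IsSStar 1 K
  oneStar with any? (λ x → ¬? (dominant? x))
  ... | no ∄¬dom = ⊥ , ≤-trans (≤-reflexive (∣⊥∣≡0 (n K))) z≤n , inj₁ clique , λ v v∈⊥ → ⊥-elim (∉⊥ v∈⊥)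
    where
      dominant : ∀ x → Dominant x
      dominant x = decidable-stable (dominant? x) λ ¬domx → ∄¬dom (x , ¬domx)
      clique : CliquePart K (_∉ ⊥)
      clique u v _ _ = dominant-clique (dominant u) (dominant v)
  ... | yes (r , ¬domr) = ⁅ r ⁆ , ≤-reflexive (∣⁅x⁆∣≡1 r) , inj₁ clique , isolated
    where
      dominant : ∀ x → x ∉ ⁅ r ⁆ → Dominant x
      dominant x x∉r = decidable-stable (dominant? x) λ ¬domx →
        x∉r (subst (_∈ ⁅ r ⁆) (¬dominant-unique ¬domr ¬domx) (x∈⁅x⁆ r))
      clique : CliquePart K (_∉ ⁅ r ⁆)
      clique u v u∉r v∉r = dominant-clique (dominant u u∉r) (dominant v v∉r)
      isolated : ∀ v → v ∈ ⁅ r ⁆ →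
        (∀ u → u ∉ ⁅ r ⁆ → adj K v u ≡ true) ⊎ (∀ u → u ∉ ⁅ r ⁆ → adj K v u ≡ false)
      isolated v v∈r with x∈⁅y⁆⇒x≡y r v∈r
      ... | refl = inj₂ λ u u∉r → ¬dominant-dominant ¬domr (dominant u u∉r)

-- χ_c(Forb H) and Forb(H)-reduced graphs

ChiC-unique : ∀ {l l′} → ChiC 𝓕 l → ChiC 𝓕 l′ → l ≡ l′
ChiC-unique ((s , s≤l , sub) , max) ((s′ , s′≤l′ , sub′) , max′) =
  ≤-antisym (max′ _ s s≤l sub) (max _ s′ s′≤l′ sub′)

¬InH⇒InH⊆Forb : ¬ InH s t H → InH s t ⊆F Forb H
¬InH⇒InH⊆Forb {s} {t} {H} ¬InH G G∈ G⊇H = ¬InH (InH-hereditary {G} {H} {s = s} {t = t} G⊇H G∈)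

InH⁺-forbidden : InH⁺ (ι K) s t ⊆F Forb H → InH⁺ 𝒢 s t H →
  ¬ (∀ K₀ → 𝒢 K₀ → n K₀ ≤ n H → Contains K K₀)
InH⁺-forbidden {H = H} forb H∈ K⊇𝒢 = forb H (InH⁺-map {G = H} K⊇𝒢 H∈) (contains-refl {H})

¬uniform : InH⁺ (ι K) s t ⊆F Forb H → InH⁺ (Uniform β) s t H → ¬ Contains K (uniform β (n H))
¬uniform {K} {H = H} {β} forb H∈ K⊇ =
  InH⁺-forbidden {K} {H = H} forb H∈ λ K₀ unif le →
    contains-trans {K} {uniform β (n H)} {K₀} K⊇ (Uniform⇒⊆uniform {K = K₀} unif le)

¬twoApex : InH⁺ (ι K) s t ⊆F Forb H → InH⁺ 𝒢 s t H → (∀ K₀ → 𝒢 K₀ → TwoApexShape α β γ K₀) →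
  ¬ Contains K (twoApex α β γ (n H))
¬twoApex {K} {H = H} {α = α} {β} {γ} forb H∈ shape K⊇ =
  InH⁺-forbidden {K} {H = H} forb H∈ λ K₀ 𝒢K₀ le →
    contains-trans {K} {twoApex α β γ (n H)} {K₀} K⊇ (TwoApexShape⇒contains {K = K₀} (shape K₀ 𝒢K₀) le)

¬InH-cliques : ¬ CliquesPlus (suc l) (λ K → Complete K ⊎ CoStar K) H → ¬ InH 0 (suc l) H
¬InH-cliques {H = H} ¬eps3 H∈ =
  ¬eps3 (InH⁺⇒CliquesPlus {G = H}
    (InH⁺-map {G = H} (λ _ complete _ → inj₁ complete) (InH⇒InH⁺-clique {G = H} H∈)))

EPS⇒InH-above : ∀ {l′} → EPS (suc l) H → suc l < l′ → s ≤ l′ → InH s (l′ ∸ s) H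
EPS⇒InH-above {l} {H} {zero} (_ , _ , ∨K₂ , _) l<l′ _ =
  InH-mono {G = H} z≤n l<l′
    (CliquesPlus-CoBipartite⇒InH {H} (CliquesPlus-map {G = H} (λ K′ K∈ _ → ∨K₂⇒CoBipartite {K′} K∈) ∨K₂))
EPS⇒InH-above {l} {H} {suc s} (eps1 , _) l<l′ _ with suc s ≤? suc l
... | yes s≤l = InH-mono {G = H} ≤-refl (∸-monoˡ-≤ (suc s) (<⇒≤ l<l′)) (eps1 (suc s) (s≤s z≤n) s≤l)
... | no s≰l  = InH-mono {G = H} (<⇒≤ (≰⇒> s≰l)) (≤-trans (≤-reflexive (n∸n≡0 l)) z≤n)
                  (eps1 (suc l) (s≤s z≤n) ≤-refl)

EPS⇒ChiC : EPS (suc l) H → ChiC (Forb H) (suc l)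
EPS⇒ChiC {l} {H} eps@(_ , _ , _ , _ , _ , ¬eps3) =
  (0 , z≤n , ¬InH⇒InH⊆Forb {H = H} (¬InH-cliques {H = H} ¬eps3)) , maximal
  where
    maximal : ∀ l′ s → s ≤ l′ → InH s (l′ ∸ s) ⊆F Forb H → l′ ≤ suc l
    maximal l′ s s≤l′ forb with l′ ≤? suc l
    ... | yes l′≤l = l′≤l
    ... | no l′≰l  = ⊥-elim (forb H (EPS⇒InH-above {H = H} eps (≰⇒> l′≰l) s≤l′) (contains-refl {H}))

Reduced-Forb : EPS (suc l) H → Reduced (Forb H) K → Σ ℕ λ s → s < suc l × InH⁺ (ι K) s (l ∸ s) ⊆F Forb H
Reduced-Forb {l} {H} eps (l′ , chiC , s , s<l′ , reduced)
  with ChiC-unique {Forb H} chiC (EPS⇒ChiC {H = H} eps)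
... | refl = s , s<l′ , λ G (c , special , stable , clique) → reduced G c special stable clique

largeReduced⇒oneStar : EPS (suc l) H → (Σ ℕ λ s → s < suc l × InH⁺ (ι K) s (l ∸ s) ⊆F Forb H) →
  Contains K (uniform true (n H + n H)) ⊎ Contains K (uniform false (n H)) → IsSStar 1 K
largeReduced⇒oneStar {H = H} {K} (eps1 , _) (s , s<l , forb) (inj₂ stable) =
  ⊥-elim (¬uniform {K} {H = H} forb (InH⇒InH⁺-stable {G = H} (eps1 (suc s) (s≤s z≤n) s<l)) stable)
largeReduced⇒oneStar {H = H} {K} (eps1 , _) (suc s , s<l@(s≤s (s≤s {n = l} s≤l)) , forb) (inj₁ clique) =
  ⊥-elim (¬uniform {K} {H = H} forb (InH⇒InH⁺-clique {G = H} H∈)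
    (contains-trans {K} {uniform true (n H + n H)} {uniform true (n H)} clique
      (Uniform⇒⊆uniform {K = uniform true (n H)} (uniform-isUniform true (n H)) (m≤m+n (n H) (n H)))))
  where
    H∈ : InH (suc s) (suc (l ∸ s)) H
    H∈ = subst (λ t → InH (suc s) t H) (+-∸-assoc 1 s≤l) (eps1 (suc s) (s≤s z≤n) (<⇒≤ s<l))
largeReduced⇒oneStar {l} {H} {K} (_ , ∨S₂ , ∨K₂ , ∧S₂ , C⁺ , _) (zero , _ , forb) (inj₁ clique) =
  OneStarFromClique.oneStar K (n H) clique
    (excluded ∨S₂ λ K₀ → ∨F⇒TwoApexShape {K = K₀} S₂ S₂-uniform ≤-refl)
    (excluded ∨K₂ λ K₀ → ∨F⇒TwoApexShape {K = K₀} K₂ K₂-uniform ≤-refl)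
    (excluded ∧S₂ λ K₀ → ∧F⇒TwoApexShape {K = K₀} S₂ S₂-uniform ≤-refl)
    (excluded C⁺  λ K₀ → Cplus⇒TwoApexShape {K₀})
  where
    excluded : ∀ {𝒢 α β γ} → CliquesPlus (suc l) 𝒢 H → (∀ K₀ → 𝒢 K₀ → TwoApexShape α β γ K₀) →
      ¬ Contains K (twoApex α β γ (n H))
    excluded H∈ = ¬twoApex {K} {H = H} forb (CliquesPlus⇒InH⁺ {G = H} H∈)

EPS⇒critical₁ : EPS (suc l) H → Critical 1 H
EPS⇒critical₁ {H = H} eps =
  ramseyBound (n H + n H) (n H) ,
  λ K reduced large →
    largeReduced⇒oneStar {H = H} {K} eps (Reduced-Forb {H = H} {K} eps reduced) (ramsey {K} (n H + n H) (n H) large)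

-- Co-stars

coStar : ℕ → Graph
coStar m = cone (uniform true m) (const false)

coStar-apex : ∀ v → adj (coStar m) zero v ≡ false
coStar-apex zero    = refl
coStar-apex (suc v) = refl

coStar-base : ∀ {u v} → u ≢ zero → v ≢ zero → u ≢ v → adj (coStar m) u v ≡ true
coStar-base {u = zero}  u≢0 _   _   = ⊥-elim (u≢0 refl)
coStar-base {v = zero}  _   v≢0 _   = ⊥-elim (v≢0 refl)
coStar-base {m} {suc u} {suc v} _ _ u≢v = uniform-isUniform true m u v (u≢v ∘ cong suc)

coStar-hereditary : Contains (coStar m) K → Complete K ⊎ CoStar K
coStar-hereditary {m} {K} (φ , φ-inj , φ-adj) with any? (λ a → φ a ≟ zero)
... | yes (a , φa≡0) = inj₂ (a , apex , λ u w u≢a w≢a u≢w →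
                          trans (φ-adj u w) (coStar-base (off-apex u≢a) (off-apex w≢a) (u≢w ∘ φ-inj)))
  where
    apex : ∀ u → adj K a u ≡ false
    apex u = trans (φ-adj a u) (trans (cong (λ x → adj (coStar m) x (φ u)) φa≡0) (coStar-apex (φ u)))
    off-apex : ∀ {u} → u ≢ a → φ u ≢ zero
    off-apex u≢a φu≡0 = u≢a (φ-inj (trans φu≡0 (sym φa≡0)))
... | no ∄a = inj₁ λ u w u≢w →
                trans (φ-adj u w) (coStar-base (λ e → ∄a (u , e)) (λ e → ∄a (w , e)) (u≢w ∘ φ-inj))

∣p∣≤0⇒x∉p : ∀ {p : Subset m} → ∣ p ∣ ≤ 0 → ∀ x → x ∉ p
∣p∣≤0⇒x∉p {p = p} ∣p∣≤0 x x∈p = <-irrefl refl (≤-trans (≤-reflexive (sym (∣⁅x⁆∣≡1 x)))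
  (≤-trans (p⊆q⇒∣p∣≤∣q∣ λ y∈⁅x⁆ → subst (_∈ p) (sym (x∈⁅y⁆⇒x≡y x y∈⁅x⁆)) x∈p) (≤-trans ∣p∣≤0 z≤n)))

coStar-not-0-star : ¬ IsSStar 0 (coStar (suc (suc m)))
coStar-not-0-star (S , ∣S∣≤0 , inj₁ clique , _) =
  true≢false (sym (clique zero (suc zero) (∣p∣≤0⇒x∉p ∣S∣≤0 _) (∣p∣≤0⇒x∉p ∣S∣≤0 _) λ ()))
coStar-not-0-star (S , ∣S∣≤0 , inj₂ stable , _) =
  true≢false (stable (suc zero) (suc (suc zero)) (∣p∣≤0⇒x∉p ∣S∣≤0 _) (∣p∣≤0⇒x∉p ∣S∣≤0 _))

coStar-reduced : EPS (suc l) H → Reduced (Forb H) (coStar m)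
coStar-reduced {l} {H} {m} eps@(_ , _ , _ , _ , _ , ¬eps3) =
  suc l , EPS⇒ChiC {H = H} eps , 0 , s≤s z≤n , λ G c special stable clique G⊇H →
    ¬eps3 (InH⁺⇒CliquesPlus {G = H}
      (InH⁺-map {G = H} (λ K coStar⊇K _ → coStar-hereditary {m} {K} coStar⊇K)
        (InH⁺-ι-hereditary {G} {H} {coStar m} G⊇H (c , special , stable , clique))))

EPS⇒¬critical₀ : EPS (suc l) H → ¬ Critical 0 H
EPS⇒¬critical₀ {H = H} eps (n₀ , critical) =
  coStar-not-0-star (critical (coStar (suc (suc n₀))) (coStar-reduced {H = H} eps) (m≤n+m n₀ 3))

lemma3p11 : ∀ (l : ℕ) → 1 ≤ l → ∀ (H : Graph) → EPS l H → Critical 1 H × ¬ Critical 0 H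
lemma3p11 (suc l) _ H eps = EPS⇒critical₁ {H = H} eps , EPS⇒¬critical₀ {H = H} eps
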